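{- $\chi_{lid}(C_m\times C_n)=4$ for every pair $(m,n)\in\{(3,7),(5,5),(5,7),(7,7)\}$.
   Context: $C_n$ denotes the cycle on $n$ vertices. A proper $k$-coloring of a graph $G$ is a map $f:V(G)\to\{1,\dots,k\}$ with $f(u)\neq f(v)$ for every edge $uv$. For a vertex $v$, $N[v]$ denotes its closed neighborhood, and $f(S)=\{f(x):x\in S\}$. A lid-coloring of $G$ is a proper coloring $f$ such that for every edge $uv$ with $N[u]\neq N[v]$ we have $f(N[u])\neq f(N[v])$; $\chi_{lid}(G)$ is the smallest number of colors in a lid-coloring of $G$. The tensor product $G\times H$ has vertex set $V(G)\times V(H)$, where $(u_1,v_1)$ and $(u_2,v_2)$ are adjacent iff $u_1u_2\in E(G)$ and $v_1v_2\in E(H)$. -}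

module Defs where

open import Data.Nat using (ℕ; suc; _<_; _∸_)
open import Data.Fin using (Fin; toℕ)
open import Data.Product using (Σ; _×_; _,_)
open import Data.Sum using (_⊎_)
open import Relation.Nullary using (¬_)
open import Relation.Binary.PropositionalEquality using (_≡_)
open import Function.Bundles using (_⇔_)

record Graph : Set₁ where
  field
    Vertex : Set
    Adj    : Vertex → Vertex → Set
open Graph public

CycAdj₀ : (n : ℕ) → Fin n → Fin n → Set
CycAdj₀ n i j = (toℕ j ≡ suc (toℕ i)) ⊎ ((toℕ i ≡ n ∸ 1) × (toℕ j ≡ 0))

Cycle : ℕ → Graph
Cycle n = record { Vertex = Fin n ; Adj = λ i j → CycAdj₀ n i j ⊎ CycAdj₀ n j i }

_⊗_ : Graph → Graph → Graph
G ⊗ H = record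
  { Vertex = Vertex G × Vertex H
  ; Adj = λ { (u₁ , v₁) (u₂ , v₂) → Adj G u₁ u₂ × Adj H v₁ v₂ } }

N[_]∋_ : {G : Graph} → Vertex G → Vertex G → Set
N[_]∋_ {G} v x = (x ≡ v) ⊎ Adj G v x

ImgN : {G : Graph} {A : Set} → (Vertex G → A) → Vertex G → A → Set
ImgN {G} f v c = Σ (Vertex G) λ x → N[_]∋_ {G} v x × (f x ≡ c)

SameN : {G : Graph} → Vertex G → Vertex G → Set
SameN {G} u v = ∀ x → (N[_]∋_ {G} u x ⇔ N[_]∋_ {G} v x)

SameImg : {G : Graph} {A : Set} → (Vertex G → A) → Vertex G → Vertex G → Set
SameImg {G} f u v = ∀ c → (ImgN {G} f u c ⇔ ImgN {G} f v c)

IsProper : (G : Graph) (k : ℕ) → (Vertex G → Fin k) → Set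
IsProper G k f = ∀ u v → Adj G u v → ¬ (f u ≡ f v)

IsLidColoring : (G : Graph) (k : ℕ) → (Vertex G → Fin k) → Set
IsLidColoring G k f =
  IsProper G k f ×
  (∀ u v → Adj G u v → ¬ SameN {G} u v → ¬ SameImg {G} f u v)

HasLidColoring : Graph → ℕ → Set
HasLidColoring G k = Σ (Vertex G → Fin k) (IsLidColoring G k)

ChiLidIs : Graph → ℕ → Set
ChiLidIs G k = HasLidColoring G k × (∀ j → j < k → ¬ HasLidColoring G j)

-- A lid 3-colouring f can tell adjacent u, v with N[u] ≠ N[v] apart only by how many colours
-- they see: f(N[u]) and f(N[v]) both contain f u and f v, and whichever contains a third colour
-- contains all three. So "f(N[v]) is full" alternates along such edges, as "f v = 0" alternates
-- along the edges of a proper 2-colouring, and a closed walk of odd length through such edges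
-- rules out both. In the four products the diagonal walk i ↦ (i mod m, i mod n) is such a walk,
-- and explicit lid 4-colourings give the upper bound.
module Submission where

open import Defs
open import Data.Nat using (ℕ; zero; suc; _+_; _*_; _∸_; _<_; z<s; s≤s; NonZero)
import Data.Nat as ℕ
open import Data.Nat.Properties using (allUpTo?)
open import Data.Nat.DivMod using (_mod_)
open import Data.Fin using (Fin; zero; suc; toℕ; #_; _≟_)
open import Data.Fin.Properties using (all?; any?)
open import Data.Product using (Σ; _×_; _,_)
open import Data.Product.Properties using (≡-dec)
open import Data.Sum using (_⊎_; inj₁; inj₂; swap)
open import Data.Vec using (Vec; []; _∷_; lookup)
open import Function using (_∘_)
open import Function.Bundles using (_⇔_; mk⇔; Equivalence)
import Function.Properties.Equivalence as ⇔
open import Relation.Binary.Definitions using (Symmetric)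
open import Relation.Binary.PropositionalEquality using (_≡_; _≢_; refl; sym; subst)
open import Relation.Nullary using (¬_; Dec; yes; no)
open import Relation.Nullary.Decidable
  using (_×-dec_; _⊎-dec_; _→-dec_; ¬?; map′; True; toWitness; ¬¬-excluded-middle)
open import Data.Empty using (⊥-elim)

open Equivalence using (to; from)

-- Alternation is tracked up to double negation because FullImage is undecidable in general.
module _ {A B C : Set} where

  disagree-disagree : ¬ (A ⇔ B) → ¬ (B ⇔ C) → ¬ ¬ (A ⇔ C)
  disagree-disagree ¬a⇔b ¬b⇔c ¬a⇔c = ¬¬-excluded-middle λ where
    (yes b) → ¬a⇔c (mk⇔ (λ a → ⊥-elim (¬a⇔b (mk⇔ (λ _ → b) (λ _ → a))))
                        (λ c → ⊥-elim (¬b⇔c (mk⇔ (λ _ → c) (λ _ → b)))))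
    (no ¬b) → ¬¬-excluded-middle λ where
      (yes c) → ¬a⇔b (mk⇔ (λ a → ⊥-elim (¬a⇔c (mk⇔ (λ _ → c) (λ _ → a)))) (⊥-elim ∘ ¬b))
      (no ¬c) → ¬b⇔c (mk⇔ (⊥-elim ∘ ¬b) (⊥-elim ∘ ¬c))

  agree-disagree : ¬ ¬ (A ⇔ B) → ¬ (B ⇔ C) → ¬ (A ⇔ C)
  agree-disagree ¬¬a⇔b ¬b⇔c a⇔c = ¬¬a⇔b λ a⇔b → ¬b⇔c (⇔.trans (⇔.sym a⇔b) a⇔c)

odd-alternation : (P : ℕ → Set) (half : ℕ) →
  (∀ {i} → i < suc (half * 2) → ¬ (P i ⇔ P (suc i))) → ¬ (P 0 ⇔ P (suc (half * 2)))
odd-alternation P zero        alternates = alternates z<s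
odd-alternation P (suc half) alternates =
  agree-disagree (disagree-disagree (alternates z<s) (alternates (s≤s z<s)))
                 (odd-alternation (P ∘ (2 +_)) half (alternates ∘ s≤s ∘ s≤s))

record OddClosedWalk (G : Graph) : Set where
  field
    half : ℕ

  length : ℕ
  length = suc (half * 2)

  field
    vertex    : ℕ → Vertex G
    closed    : vertex length ≡ vertex 0
    adjacent  : ∀ {i} → i < length → Adj G (vertex i) (vertex (suc i))
    not-twins : ∀ {i} → i < length → ¬ SameN {G} (vertex i) (vertex (suc i))

  no-alternating-property : (Q : Vertex G → Set) →
    ¬ (∀ {i} → i < length → ¬ (Q (vertex i) ⇔ Q (vertex (suc i))))
  no-alternating-property Q alternates =
    odd-alternation (Q ∘ vertex) half alternates
      (subst (λ v → Q (vertex 0) ⇔ Q v) (sym closed) ⇔.refl)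

≢⇒zero-alternates : {a b : Fin 2} → a ≢ b → ¬ (a ≡ zero ⇔ b ≡ zero)
≢⇒zero-alternates {zero}     {zero}     a≢b _   = a≢b refl
≢⇒zero-alternates {zero}     {suc zero} _   a⇔b with () ← to a⇔b refl
≢⇒zero-alternates {suc zero} {zero}     _   a⇔b with () ← from a⇔b refl
≢⇒zero-alternates {suc zero} {suc zero} a≢b _   = a≢b refl

Fin3-covered-by-distinct : (a b c : Fin 3) → a ≢ b → c ≢ a → c ≢ b →
  ∀ d → d ≡ a ⊎ d ≡ b ⊎ d ≡ c
Fin3-covered-by-distinct = toWitness {a? = covered?} _
  where
  covered? = all? λ a → all? λ b → all? λ c →
    ¬? (a ≟ b) →-dec ¬? (c ≟ a) →-dec ¬? (c ≟ b) →-dec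
    all? λ d → (d ≟ a) ⊎-dec (d ≟ b) ⊎-dec (d ≟ c)

FullImage : {G : Graph} {k : ℕ} → (Vertex G → Fin k) → Vertex G → Set
FullImage {G} f v = ∀ c → ImgN {G} f v c

module ThreeColors {G : Graph} (adj-sym : Symmetric (Adj G)) (f : Vertex G → Fin 3) where

  full-if-third-color : ∀ {u v c} → Adj G u v → f u ≢ f v → c ≢ f u → c ≢ f v →
    ImgN {G} f u c → FullImage {G} f u
  full-if-third-color {u} {v} {c} u~v fu≢fv c≢fu c≢fv img d
    with Fin3-covered-by-distinct (f u) (f v) c fu≢fv c≢fu c≢fv d
  ... | inj₁ refl        = u , inj₁ refl , refl
  ... | inj₂ (inj₁ refl) = v , inj₂ u~v , refl
  ... | inj₂ (inj₂ refl) = img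

  image-inclusion : ∀ {u v} → Adj G u v → f u ≢ f v →
    (FullImage {G} f u → FullImage {G} f v) → ∀ c → ImgN {G} f u c → ImgN {G} f v c
  image-inclusion {u} {v} u~v fu≢fv full⇒full c img with c ≟ f u | c ≟ f v
  ... | yes refl | _        = u , inj₂ (adj-sym u~v) , refl
  ... | no _     | yes refl = v , inj₁ refl , refl
  ... | no c≢fu  | no c≢fv  = full⇒full (full-if-third-color u~v fu≢fv c≢fu c≢fv img) c

  lid-full-alternates : IsLidColoring G 3 f → ∀ {u v} → Adj G u v → ¬ SameN {G} u v →
    ¬ (FullImage {G} f u ⇔ FullImage {G} f v)
  lid-full-alternates (proper , distinguishes) {u} {v} u~v not-twins full⇔full =
    distinguishes u v u~v not-twins λ c →
      mk⇔ (image-inclusion u~v fu≢fv (to full⇔full) c)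
          (image-inclusion (adj-sym u~v) (fu≢fv ∘ sym) (from full⇔full) c)
    where
    fu≢fv = proper u v u~v

lid-coloring-needs-4 : {G : Graph} → Symmetric (Adj G) → OddClosedWalk G →
  ∀ j → j < 4 → ¬ HasLidColoring G j
lid-coloring-needs-4 {G} adj-sym walk = needs
  where
  open OddClosedWalk walk
  needs : ∀ j → j < 4 → ¬ HasLidColoring G j
  needs 0 _ (f , _) with () ← f (vertex 0)
  needs 1 _ (f , proper , _)
    with f (vertex 0) | f (vertex 1) | proper (vertex 0) (vertex 1) (adjacent z<s)
  ... | zero | zero | f₀≢f₁ = f₀≢f₁ refl
  needs 2 _ (f , proper , _) = no-alternating-property (λ v → f v ≡ zero) λ i<L →
    ≢⇒zero-alternates (proper _ _ (adjacent i<L))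
  needs 3 _ (f , lid) = no-alternating-property (FullImage {G} f) λ i<L →
    ThreeColors.lid-full-alternates adj-sym f lid (adjacent i<L) (not-twins i<L)
  needs (suc (suc (suc (suc _)))) (s≤s (s≤s (s≤s (s≤s ()))))

χlid≡4 : {G : Graph} → Symmetric (Adj G) → OddClosedWalk G → HasLidColoring G 4 →
  ChiLidIs G 4
χlid≡4 adj-sym walk coloring = coloring , lid-coloring-needs-4 adj-sym walk

Cycle-symmetric : ∀ n → Symmetric (Adj (Cycle n))
Cycle-symmetric n = swap

⊗-symmetric : ∀ {G H} → Symmetric (Adj G) → Symmetric (Adj H) → Symmetric (Adj (G ⊗ H))
⊗-symmetric G-sym H-sym {_ , _} {_ , _} (u₁~u₂ , v₁~v₂) = G-sym u₁~u₂ , H-sym v₁~v₂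

_⇔?_ : {A B : Set} → Dec A → Dec B → Dec (A ⇔ B)
a? ⇔? b? = map′ (λ (a→b , b→a) → mk⇔ a→b b→a) (λ a⇔b → to a⇔b , from a⇔b)
                ((a? →-dec b?) ×-dec (b? →-dec a?))

CycAdj₀? : ∀ n (i j : Fin n) → Dec (CycAdj₀ n i j)
CycAdj₀? n i j = (toℕ j ℕ.≟ suc (toℕ i)) ⊎-dec ((toℕ i ℕ.≟ n ∸ 1) ×-dec (toℕ j ℕ.≟ 0))

Cycle-Adj? : ∀ n (i j : Fin n) → Dec (Adj (Cycle n) i j)
Cycle-Adj? n i j = CycAdj₀? n i j ⊎-dec CycAdj₀? n j i

module CycleProduct (m n : ℕ) .{{_ : NonZero m}} .{{_ : NonZero n}} where

  G : Graph
  G = Cycle m ⊗ Cycle n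

  V : Set
  V = Fin m × Fin n

  Adj-symmetric : Symmetric (Adj G)
  Adj-symmetric = ⊗-symmetric {Cycle m} {Cycle n} (Cycle-symmetric m) (Cycle-symmetric n)

  all-vertices? : {P : V → Set} → (∀ v → Dec (P v)) → Dec (∀ v → P v)
  all-vertices? P? = map′ (λ ∀P (a , b) → ∀P a b) (λ ∀P a b → ∀P (a , b))
                          (all? λ a → all? λ b → P? (a , b))

  some-vertex? : {P : V → Set} → (∀ v → Dec (P v)) → Dec (Σ V P)
  some-vertex? P? = map′ (λ (a , b , p) → (a , b) , p) (λ ((a , b) , p) → a , b , p)
                         (any? λ a → any? λ b → P? (a , b))

  Adj? : (u v : V) → Dec (Adj G u v)
  Adj? (a , b) (c , d) = Cycle-Adj? m a c ×-dec Cycle-Adj? n b d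

  N[_]∋? : (v x : V) → Dec (N[_]∋_ {G} v x)
  N[ v ]∋? x = ≡-dec _≟_ _≟_ x v ⊎-dec Adj? v x

  SameN? : (u v : V) → Dec (SameN {G} u v)
  SameN? u v = all-vertices? λ x → N[ u ]∋? x ⇔? N[ v ]∋? x

  ImgN? : ∀ {k} (f : V → Fin k) (v : V) (c : Fin k) → Dec (ImgN {G} f v c)
  ImgN? f v c = some-vertex? λ x → N[ v ]∋? x ×-dec (f x ≟ c)

  SameImg? : ∀ {k} (f : V → Fin k) (u v : V) → Dec (SameImg {G} f u v)
  SameImg? f u v = all? λ c → ImgN? f u c ⇔? ImgN? f v c

  IsLidColoring? : ∀ {k} (f : V → Fin k) → Dec (IsLidColoring G k f)
  IsLidColoring? f =
    (all-vertices? λ u → all-vertices? λ v → Adj? u v →-dec ¬? (f u ≟ f v)) ×-dec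
    (all-vertices? λ u → all-vertices? λ v →
       Adj? u v →-dec ¬? (SameN? u v) →-dec ¬? (SameImg? f u v))

  tabulated : Vec (Vec (Fin 4) n) m → V → Fin 4
  tabulated rows (a , b) = lookup (lookup rows a) b

  tabulated-lid-coloring : (rows : Vec (Vec (Fin 4) n) m) →
    True (IsLidColoring? (tabulated rows)) → HasLidColoring G 4
  tabulated-lid-coloring rows is-lid = tabulated rows , toWitness is-lid

  diagonal : ℕ → V
  diagonal i = i mod m , i mod n

  diagonal-walk : (half : ℕ) → diagonal (suc (half * 2)) ≡ diagonal 0 →
    True (allUpTo? (λ i → Adj? (diagonal i) (diagonal (suc i))) (suc (half * 2))) →
    True (allUpTo? (λ i → ¬? (SameN? (diagonal i) (diagonal (suc i)))) (suc (half * 2))) →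
    OddClosedWalk G
  diagonal-walk half closed adjacent not-twins = record
    { half      = half
    ; vertex    = diagonal
    ; closed    = closed
    ; adjacent  = toWitness adjacent
    ; not-twins = toWitness not-twins
    }

C₃×C₇ : ChiLidIs (Cycle 3 ⊗ Cycle 7) 4
C₃×C₇ = χlid≡4 Adj-symmetric (diagonal-walk 10 refl _ _) (tabulated-lid-coloring
  ( (# 0 ∷ # 0 ∷ # 1 ∷ # 0 ∷ # 1 ∷ # 2 ∷ # 3 ∷ [])
  ∷ (# 1 ∷ # 3 ∷ # 2 ∷ # 3 ∷ # 1 ∷ # 0 ∷ # 3 ∷ [])
  ∷ (# 1 ∷ # 3 ∷ # 2 ∷ # 3 ∷ # 1 ∷ # 2 ∷ # 3 ∷ [])
  ∷ []) _)
  where open CycleProduct 3 7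

C₅×C₅ : ChiLidIs (Cycle 5 ⊗ Cycle 5) 4
C₅×C₅ = χlid≡4 Adj-symmetric (diagonal-walk 2 refl _ _) (tabulated-lid-coloring
  ( (# 0 ∷ # 0 ∷ # 0 ∷ # 0 ∷ # 0 ∷ [])
  ∷ (# 1 ∷ # 1 ∷ # 1 ∷ # 2 ∷ # 2 ∷ [])
  ∷ (# 0 ∷ # 0 ∷ # 3 ∷ # 3 ∷ # 3 ∷ [])
  ∷ (# 1 ∷ # 1 ∷ # 1 ∷ # 1 ∷ # 1 ∷ [])
  ∷ (# 2 ∷ # 2 ∷ # 3 ∷ # 3 ∷ # 3 ∷ [])
  ∷ []) _)
  where open CycleProduct 5 5

C₅×C₇ : ChiLidIs (Cycle 5 ⊗ Cycle 7) 4
C₅×C₇ = χlid≡4 Adj-symmetric (diagonal-walk 17 refl _ _) (tabulated-lid-coloring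
  ( (# 0 ∷ # 0 ∷ # 0 ∷ # 0 ∷ # 0 ∷ # 0 ∷ # 0 ∷ [])
  ∷ (# 1 ∷ # 1 ∷ # 1 ∷ # 1 ∷ # 1 ∷ # 1 ∷ # 2 ∷ [])
  ∷ (# 0 ∷ # 0 ∷ # 3 ∷ # 3 ∷ # 0 ∷ # 0 ∷ # 2 ∷ [])
  ∷ (# 1 ∷ # 1 ∷ # 1 ∷ # 1 ∷ # 1 ∷ # 1 ∷ # 1 ∷ [])
  ∷ (# 2 ∷ # 3 ∷ # 3 ∷ # 2 ∷ # 2 ∷ # 3 ∷ # 3 ∷ [])
  ∷ []) _)
  where open CycleProduct 5 7

C₇×C₇ : ChiLidIs (Cycle 7 ⊗ Cycle 7) 4
C₇×C₇ = χlid≡4 Adj-symmetric (diagonal-walk 3 refl _ _) (tabulated-lid-coloring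
  ( (# 0 ∷ # 0 ∷ # 0 ∷ # 0 ∷ # 0 ∷ # 0 ∷ # 0 ∷ [])
  ∷ (# 1 ∷ # 1 ∷ # 1 ∷ # 1 ∷ # 1 ∷ # 1 ∷ # 1 ∷ [])
  ∷ (# 0 ∷ # 0 ∷ # 0 ∷ # 0 ∷ # 0 ∷ # 0 ∷ # 0 ∷ [])
  ∷ (# 1 ∷ # 1 ∷ # 2 ∷ # 2 ∷ # 1 ∷ # 2 ∷ # 2 ∷ [])
  ∷ (# 0 ∷ # 0 ∷ # 0 ∷ # 3 ∷ # 3 ∷ # 3 ∷ # 0 ∷ [])
  ∷ (# 2 ∷ # 2 ∷ # 2 ∷ # 2 ∷ # 2 ∷ # 2 ∷ # 2 ∷ [])
  ∷ (# 1 ∷ # 1 ∷ # 3 ∷ # 3 ∷ # 1 ∷ # 3 ∷ # 3 ∷ [])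
  ∷ []) _)
  where open CycleProduct 7 7

lemma21 : (m n : ℕ) →
    ((m ≡ 3 × n ≡ 7) ⊎ (m ≡ 5 × n ≡ 5) ⊎ (m ≡ 5 × n ≡ 7) ⊎ (m ≡ 7 × n ≡ 7)) →
    ChiLidIs (Cycle m ⊗ Cycle n) 4
lemma21 .3 .7 (inj₁ (refl , refl))                   = C₃×C₇
lemma21 .5 .5 (inj₂ (inj₁ (refl , refl)))             = C₅×C₅
lemma21 .5 .7 (inj₂ (inj₂ (inj₁ (refl , refl))))      = C₅×C₇
lemma21 .7 .7 (inj₂ (inj₂ (inj₂ (refl , refl))))      = C₇×C₇
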